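{- For every string $x\in\{0,1\}^*$, the graph $G_x$ defined below has a perfect matching if and only if $x$ has even parity (i.e., the number of $1$'s in $x$ is even).
   Context: Construction of $G_x$. For $x=x_1\cdots x_n$ let $f(x)=0\,\mathrm{bd}(0x_10x_20\cdots0x_n0)\,0$, where $\mathrm{bd}(y_1\cdots y_k)=y_1y_1\cdots y_ky_k$. Write $f(x)=y_1\cdots y_m$ ($m$ even) and split it into constituent pairs $P_k=y_{2k-1}y_{2k}$, $k=1,\dots,m/2$; each $P_k\in\{00,01,10\}$. Three blocks are defined, each drawn in a $2\times 6$ piece of the integer lattice with local columns $0,1$ and rows $0,\dots,5$: - $G_{00}$: vertices $(0,0),(1,0),(0,5),(1,5),(0,2),(0,3)$; edges $(0,0)(1,0)$, $(0,5)(1,5)$, $(0,2)(0,3)$. - $G_{01}$: vertices $(0,1),(1,1),(0,4),(1,4),(1,2),(1,3)$; edges $(0,1)(1,1)$, $(0,4)(1,4)$, $(1,2)(1,3)$. - $G_{10}$: vertices $(0,0),(1,0),(0,5),(1,5),(0,1),(0,4)$; edges $(0,0)(1,0)$, $(0,0)(0,1)$, $(0,5)(1,5)$, $(0,5)(0,4)$. $G_x=G_{P_1}\odot\cdots\odot G_{P_{m/2}}$ is obtained by placing a copy of block $G_{P_k}$ in global columns $2k-2,2k-1$, and for each $k<m/2$ adding the two edges $(2k-1,a_k)(2k,b_{k+1})$ and $(2k-1,5-a_k)(2k,5-b_{k+1})$, where $a_k=1$ if $P_k=01$ and $0$ otherwise, and $b_{k+1}=1$ if $P_{k+1}\in\{01,10\}$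 and $0$ if $P_{k+1}=00$. -}

module Defs where

open import Data.Bool using (Bool; true; false)
open import Data.Nat using (ℕ; zero; suc; _+_; _*_; _∸_)
import Data.Nat.Properties as ℕP
open import Data.Product using (_×_; _,_; proj₁; proj₂; Σ)
open import Data.Product.Properties using (≡-dec)
open import Data.Sum using (_⊎_)
open import Data.List using (List; []; _∷_; _++_; concatMap; length; filter)
open import Data.List.Relation.Unary.All using (All)
open import Data.List.Membership.Propositional using (_∈_)
open import Relation.Nullary using (Dec)
open import Relation.Nullary.Decidable using (_⊎-dec_)
open import Relation.Binary.PropositionalEquality using (_≡_)

-- Bits are Booleans: false = 0, true = 1.

ones : List Bool → ℕ
ones []           = 0
ones (true  ∷ xs) = suc (ones xs)
ones (false ∷ xs) = ones xs

bd : List Bool → List Bool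
bd []       = []
bd (y ∷ ys) = y ∷ y ∷ bd ys

interleave : List Bool → List Bool
interleave x = concatMap (λ b → false ∷ b ∷ []) x ++ (false ∷ [])

f : List Bool → List Bool
f x = false ∷ bd (interleave x) ++ (false ∷ [])

-- split y₁⋯y_m into constituent pairs P_k = y_{2k-1} y_{2k}
-- (f x always has even length, so no bit is ever left over)
pairs : List Bool → List (Bool × Bool)
pairs (a ∷ b ∷ ys) = (a , b) ∷ pairs ys
pairs _            = []

-- Graphs on the integer lattice (points (column , row) with ℕ coordinates)

Point : Set
Point = ℕ × ℕ

Edge : Set
Edge = Point × Point

record Graph : Set where
  constructor graph
  field
    vertices : List Point
    edges    : List Edge
open Graph public

_≟P_ : (u v : Point) → Dec (u ≡ v)
_≟P_ = ≡-dec ℕP._≟_ ℕP._≟_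

incident? : (v : Point) (e : Edge) → Dec ((v ≡ proj₁ e) ⊎ (v ≡ proj₂ e))
incident? v (p , q) = (v ≟P p) ⊎-dec (v ≟P q)

IsPerfectMatching : Graph → List Edge → Set
IsPerfectMatching G M =
  All (_∈ edges G) M ×
  All (λ v → length (filter (incident? v) M) ≡ 1) (vertices G)

HasPerfectMatching : Graph → Set
HasPerfectMatching G = Σ (List Edge) (IsPerfectMatching G)

-- The blocks G₀₀, G₀₁, G₁₀, placed in global columns c , c+1.
-- Pair 11 never occurs in f x; it is given the empty block.

blockV : ℕ → Bool × Bool → List Point
blockV c (false , false) =
  (c , 0) ∷ (c + 1 , 0) ∷ (c , 5) ∷ (c + 1 , 5) ∷ (c , 2) ∷ (c , 3) ∷ []
blockV c (false , true) =
  (c , 1) ∷ (c + 1 , 1) ∷ (c , 4) ∷ (c + 1 , 4) ∷ (c + 1 , 2) ∷ (c + 1 , 3) ∷ []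
blockV c (true , false) =
  (c , 0) ∷ (c + 1 , 0) ∷ (c , 5) ∷ (c + 1 , 5) ∷ (c , 1) ∷ (c , 4) ∷ []
blockV c (true , true) = []

blockE : ℕ → Bool × Bool → List Edge
blockE c (false , false) =
  ((c , 0) , (c + 1 , 0)) ∷ ((c , 5) , (c + 1 , 5)) ∷ ((c , 2) , (c , 3)) ∷ []
blockE c (false , true) =
  ((c , 1) , (c + 1 , 1)) ∷ ((c , 4) , (c + 1 , 4)) ∷ ((c + 1 , 2) , (c + 1 , 3)) ∷ []
blockE c (true , false) =
  ((c , 0) , (c + 1 , 0)) ∷ ((c , 0) , (c , 1)) ∷
  ((c , 5) , (c + 1 , 5)) ∷ ((c , 5) , (c , 4)) ∷ []
blockE c (true , true) = []

aOf : Bool × Bool → ℕ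
aOf (false , true) = 1
aOf _              = 0

bOf : Bool × Bool → ℕ
bOf (false , false) = 0
bOf _               = 1

connect : ℕ → Bool × Bool → Bool × Bool → List Edge
connect c P Q =
  ((c + 1 , aOf P) , (c + 2 , bOf Q)) ∷
  ((c + 1 , 5 ∸ aOf P) , (c + 2 , 5 ∸ bOf Q)) ∷ []

chainV : ℕ → List (Bool × Bool) → List Point
chainV c []       = []
chainV c (P ∷ Ps) = blockV c P ++ chainV (c + 2) Ps

chainE : ℕ → List (Bool × Bool) → List Edge
chainE c []             = []
chainE c (P ∷ [])       = blockE c P
chainE c (P ∷ Q ∷ Ps)   = blockE c P ++ connect c P Q ++ chainE (c + 2) (Q ∷ Ps)

G : List Bool → Graph
G x = graph (chainV 0 (pairs (f x))) (chainE 0 (pairs (f x)))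

module Submission where

-- G_x is a chain of blocks G₀₀, G₀₁, G₁₀ joined by pairs of link edges.  We prove for
-- every chain of such blocks that it has a perfect matching iff it contains an even
-- number of G₁₀ blocks ("twists"); lemma5 follows since pairs (f x) is the chain
-- 00 (01 10 | 00 00)* 00, with one twist for each 1 of x.
-- (⇒) Rows 0 and 1 are low.  Every edge joins two low or two high vertices, so a perfect
--     matching pairs up the low vertices; a block has two of them, a twist three.
-- (⇐) Sweep left to right carrying one bit: are the two link edges entering the current
--     block used?  Every block can be completed for either bit and only twists flip it,
--     so the sweep ends with bit 0 iff the number of twists is even; the edges chosen
--     then cover every vertex exactly once.

open import Defs
open import Data.Bool using (Bool; true; false; if_then_else_)
open import Data.Empty using (⊥-elim)
open import Data.List using (List; []; _∷_; _++_; length; filter; map)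
open import Data.List.Properties using (map-++; ++-identityʳ; filter-accept; filter-reject)
open import Data.List.Relation.Unary.All as All using (All; []; _∷_)
import Data.List.Relation.Unary.All.Properties as All
open import Data.List.Relation.Unary.Any using (here; there)
open import Data.List.Membership.Propositional using (_∈_)
open import Data.List.Membership.Propositional.Properties using (∈-map⁺)
open import Data.List.Membership.DecPropositional _≟P_ using (_∈?_)
open import Data.List.Relation.Binary.Subset.Propositional using (_⊆_)
open import Data.List.Relation.Binary.Subset.Propositional.Properties
  using (⊆-refl; xs⊆xs++ys; xs⊆ys++xs; ++⁺; ++⁺ʳ)
open import Data.List.Relation.Unary.Unique.Propositional using (Unique; []; _∷_)
import Data.List.Relation.Unary.Unique.Propositional.Properties as Unique
open import Data.List.Relation.Unary.Unique.DecPropositional _≟P_ using (unique?)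
open import Data.Nat using (ℕ; suc; _+_; _*_; _∸_; _≤_; _≤?_; _≤ᵇ_; parity)
import Data.Nat.Properties as ℕ
open import Data.Nat.Divisibility using (_∣_; divides; ∣m+n∣m⇒∣n; ∣m∣n⇒∣m+n; m∣m*n)
open import Data.Nat.ListAction using (sum)
open import Data.Nat.ListAction.Properties using (sum-++)
open import Data.Nat.Tactic.RingSolver using (solve-∀)
open import Data.Parity using (Parity; 0ℙ; 1ℙ) renaming (_+_ to _⊕_)
import Data.Parity.Properties as Parity
open import Data.Product using (_×_; _,_; proj₁; proj₂)
open import Data.Sum using (inj₁; inj₂; [_,_])
open import Function using (id)
open import Function.Bundles using (_⇔_; mk⇔)
open import Relation.Nullary using (Dec; yes; no; ¬_)
open import Relation.Nullary.Decidable using (_×-dec_; ¬?; from-yes; map′)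
open import Relation.Binary.PropositionalEquality
  using (_≡_; _≢_; refl; sym; trans; cong; cong₂; subst; subst₂; module ≡-Reasoning)

∑ : {A : Set} → List A → (A → ℕ) → ℕ
∑ xs f = sum (map f xs)

∑-++ : {A : Set} (xs ys : List A) (f : A → ℕ) → ∑ (xs ++ ys) f ≡ ∑ xs f + ∑ ys f
∑-++ xs ys f = trans (cong sum (map-++ f xs ys)) (sum-++ (map f xs) (map f ys))

∑-+ : {A : Set} (xs : List A) (f g : A → ℕ) → ∑ xs (λ x → f x + g x) ≡ ∑ xs f + ∑ xs g
∑-+ []       f g = refl
∑-+ (x ∷ xs) f g = trans (cong (f x + g x +_) (∑-+ xs f g)) (interchange (f x) (g x) _ _)
  where
  interchange : ∀ a b c d → (a + b) + (c + d) ≡ (a + c) + (b + d)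
  interchange = solve-∀

∑-cong : {A : Set} {f g : A → ℕ} (xs : List A) → All (λ x → f x ≡ g x) xs → ∑ xs f ≡ ∑ xs g
∑-cong []       []       = refl
∑-cong (x ∷ xs) (e ∷ es) = cong₂ _+_ e (∑-cong xs es)

∑-zero : {A : Set} {f : A → ℕ} (xs : List A) → All (λ x → f x ≡ 0) xs → ∑ xs f ≡ 0
∑-zero []       []       = refl
∑-zero (x ∷ xs) (e ∷ es) = cong₂ _+_ e (∑-zero xs es)

⟦_⟧ : {A : Set} → Dec A → ℕ
⟦ yes _ ⟧ = 1
⟦ no _ ⟧  = 0

⟦⟧-yes : {A : Set} (d : Dec A) → A → ⟦ d ⟧ ≡ 1
⟦⟧-yes (yes _) _ = refl
⟦⟧-yes (no ¬a) a = ⊥-elim (¬a a)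

⟦⟧-no : {A : Set} (d : Dec A) → ¬ A → ⟦ d ⟧ ≡ 0
⟦⟧-no (yes a) ¬a = ⊥-elim (¬a a)
⟦⟧-no (no _)  _  = refl

δ : Point → Point → ℕ
δ u v = ⟦ u ≟P v ⟧

δ-refl : ∀ u → δ u u ≡ 1
δ-refl u = ⟦⟧-yes (u ≟P u) refl

δ-≢ : ∀ {u v} → u ≢ v → δ u v ≡ 0
δ-≢ {u} {v} = ⟦⟧-no (u ≟P v)

δ-sym : ∀ u v → δ u v ≡ δ v u
δ-sym u v = by-cases (u ≟P v)
  where
  by-cases : Dec (u ≡ v) → δ u v ≡ δ v u
  by-cases (yes u≡v) = trans (⟦⟧-yes (u ≟P v) u≡v) (sym (⟦⟧-yes (v ≟P u) (sym u≡v)))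
  by-cases (no u≢v)  = trans (δ-≢ u≢v) (sym (δ-≢ (λ v≡u → u≢v (sym v≡u))))

occ : List Point → Point → ℕ
occ L v = ∑ L (δ v)

occ-++ : ∀ A B v → occ (A ++ B) v ≡ occ A v + occ B v
occ-++ A B v = ∑-++ A B (δ v)

weigh-δ : (w : Point → ℕ) {V : List Point} {u : Point} → Unique V → u ∈ V →
          ∑ V (λ v → w v * δ v u) ≡ w u
weigh-δ w {x ∷ V} (x∉V ∷ _) (here refl) =
  trans (cong₂ _+_ (trans (cong (w x *_) (δ-refl x)) (ℕ.*-identityʳ (w x)))
                   (∑-zero V (All.map (λ {v} x≢v → vanish v (δ-≢ (λ v≡x → x≢v (sym v≡x)))) x∉V)))
        (ℕ.+-identityʳ (w x))
  where
  vanish : ∀ v → δ v x ≡ 0 → w v * δ v x ≡ 0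
  vanish v d = trans (cong (w v *_) d) (ℕ.*-zeroʳ (w v))
weigh-δ w {x ∷ V} {u} (x∉V ∷ uV) (there u∈V) =
  trans (cong (_+ ∑ V (λ v → w v * δ v u))
              (trans (cong (w x *_) (δ-≢ (All.lookup x∉V u∈V))) (ℕ.*-zeroʳ (w x))))
        (weigh-δ w uV u∈V)

weigh-occ : (w : Point → ℕ) {V : List Point} (L : List Point) → Unique V → All (_∈ V) L →
            ∑ V (λ v → w v * occ L v) ≡ ∑ L w
weigh-occ w {V} []      uV []            = ∑-zero V (All.tabulate (λ {v} _ → ℕ.*-zeroʳ (w v)))
weigh-occ w {V} (u ∷ L) uV (u∈V ∷ L⊆V) = begin
  ∑ V (λ v → w v * (δ v u + occ L v))
    ≡⟨ ∑-cong V (All.tabulate (λ {v} _ → ℕ.*-distribˡ-+ (w v) (δ v u) (occ L v))) ⟩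
  ∑ V (λ v → w v * δ v u + w v * occ L v)
    ≡⟨ ∑-+ V (λ v → w v * δ v u) (λ v → w v * occ L v) ⟩
  ∑ V (λ v → w v * δ v u) + ∑ V (λ v → w v * occ L v)
    ≡⟨ cong₂ _+_ (weigh-δ w uV u∈V) (weigh-occ w L uV L⊆V) ⟩
  w u + ∑ L w
    ∎
  where open ≡-Reasoning

occ-unique : ∀ {V v} → Unique V → v ∈ V → occ V v ≡ 1
occ-unique {V} {v} uV v∈V =
  trans (∑-cong V (All.tabulate (λ {u} _ → trans (δ-sym v u) (sym (ℕ.*-identityˡ (δ u v))))))
        (weigh-δ (λ _ → 1) uV v∈V)

ends : List Edge → List Point
ends []            = []
ends ((p , q) ∷ M) = p ∷ q ∷ ends M

ends-++ : ∀ M N → ends (M ++ N) ≡ ends M ++ ends N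
ends-++ []            N = refl
ends-++ ((p , q) ∷ M) N = cong (λ L → p ∷ q ∷ L) (ends-++ M N)

occ-ends-++ : ∀ M N v → occ (ends (M ++ N)) v ≡ occ (ends M) v + occ (ends N) v
occ-ends-++ M N v = trans (cong (λ L → occ L v) (ends-++ M N)) (occ-++ (ends M) (ends N) v)

NonLoop : Edge → Set
NonLoop (p , q) = p ≢ q

degree : List Edge → Point → ℕ
degree M v = length (filter (incident? v) M)

degree-ends : ∀ {M} → All NonLoop M → ∀ v → degree M v ≡ occ (ends M) v
degree-ends {[]}          []           v = refl
degree-ends {(p , q) ∷ M} (p≢q ∷ nls) v = by-cases (v ≟P p) (v ≟P q)
  where
  open ≡-Reasoning
  rest : ℕ
  rest = occ (ends M) v
  by-cases : Dec (v ≡ p) → Dec (v ≡ q) → degree ((p , q) ∷ M) v ≡ δ v p + (δ v q + rest)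
  by-cases (yes v≡p) (yes v≡q) = ⊥-elim (p≢q (trans (sym v≡p) v≡q))
  by-cases (yes v≡p) (no v≢q) = begin
    degree ((p , q) ∷ M) v  ≡⟨ cong length (filter-accept (incident? v) (inj₁ v≡p)) ⟩
    suc (degree M v)        ≡⟨ cong suc (degree-ends nls v) ⟩
    1 + (0 + rest)          ≡⟨ cong₂ (λ a b → a + (b + rest))
                                      (sym (⟦⟧-yes (v ≟P p) v≡p)) (sym (δ-≢ v≢q)) ⟩
    δ v p + (δ v q + rest)  ∎
  by-cases (no v≢p) (yes v≡q) = begin
    degree ((p , q) ∷ M) v  ≡⟨ cong length (filter-accept (incident? v) (inj₂ v≡q)) ⟩
    suc (degree M v)        ≡⟨ cong suc (degree-ends nls v) ⟩
    0 + (1 + rest)          ≡⟨ cong₂ (λ a b → a + (b + rest))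
                                      (sym (δ-≢ v≢p)) (sym (⟦⟧-yes (v ≟P q) v≡q)) ⟩
    δ v p + (δ v q + rest)  ∎
  by-cases (no v≢p) (no v≢q) = begin
    degree ((p , q) ∷ M) v  ≡⟨ cong length (filter-reject (incident? v) [ v≢p , v≢q ]) ⟩
    degree M v              ≡⟨ degree-ends nls v ⟩
    0 + (0 + rest)          ≡⟨ cong₂ (λ a b → a + (b + rest)) (sym (δ-≢ v≢p)) (sym (δ-≢ v≢q)) ⟩
    δ v p + (δ v q + rest)  ∎

ends-even : (w : Point → ℕ) (M : List Edge) → All (λ e → w (proj₁ e) ≡ w (proj₂ e)) M →
            2 ∣ ∑ (ends M) w
ends-even w []            []            = divides 0 refl
ends-even w ((p , q) ∷ M) (wp≡wq ∷ bal) =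
  subst (2 ∣_) (ℕ.+-assoc (w p) (w q) _) (∣m∣n⇒∣m+n (divides (w p) pair-weight) (ends-even w M bal))
  where
  double : ∀ n → n + n ≡ n * 2
  double = solve-∀
  pair-weight : w p + w q ≡ w p * 2
  pair-weight = trans (cong (w p +_) (sym wp≡wq)) (double (w p))

Proper : (Point → ℕ) → List Point → Edge → Set
Proper w V (p , q) = p ∈ V × q ∈ V × p ≢ q × w p ≡ w q

proper-nonloop : ∀ {w V e} → Proper w V e → NonLoop e
proper-nonloop (_ , _ , p≢q , _) = p≢q

proper-weaken : ∀ {w V V'} → V ⊆ V' → ∀ {e} → Proper w V e → Proper w V' e
proper-weaken V⊆V' (p∈ , q∈ , p≢q , wp≡wq) = V⊆V' p∈ , V⊆V' q∈ , p≢q , wp≡wq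

-- Parity obstruction: if every edge of Γ joins vertices of equal weight, a perfect
-- matching forces the total weight of the (duplicate-free) vertex list to be even,
-- since that total equals the weight of the endpoint list of the matching.
perfect⇒even : (w : Point → ℕ) (Γ : Graph) → Unique (vertices Γ) →
               All (Proper w (vertices Γ)) (edges Γ) → HasPerfectMatching Γ →
               2 ∣ ∑ (vertices Γ) w
perfect⇒even w (graph V E) uV proper (M , M⊆E , perfect) =
  subst (2 ∣_) (sym total) (ends-even w M balanced)
  where
  open ≡-Reasoning
  properM : All (Proper w V) M
  properM = All.map (All.lookup proper) M⊆E
  balanced : All (λ e → w (proj₁ e) ≡ w (proj₂ e)) M
  balanced = All.map (λ (_ , _ , _ , wp≡wq) → wp≡wq) properM
  nonloops : All NonLoop M
  nonloops = All.map (proper-nonloop {w}) properM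
  ends⊆V : ∀ N → All (Proper w V) N → All (_∈ V) (ends N)
  ends⊆V []      []                       = []
  ends⊆V (_ ∷ N) ((p∈ , q∈ , _ , _) ∷ ps) = p∈ ∷ q∈ ∷ ends⊆V N ps
  total : ∑ V w ≡ ∑ (ends M) w
  total = begin
    ∑ V w
      ≡⟨ ∑-cong V (All.map (λ {v} deg≡1 → trans (sym (ℕ.*-identityʳ (w v))) (cong (w v *_) (sym deg≡1)))
                           perfect) ⟩
    ∑ V (λ v → w v * degree M v)
      ≡⟨ ∑-cong V (All.tabulate (λ {v} _ → cong (w v *_) (degree-ends nonloops v))) ⟩
    ∑ V (λ v → w v * occ (ends M) v)
      ≡⟨ weigh-occ w (ends M) uV (ends⊆V M properM) ⟩
    ∑ (ends M) w
      ∎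

covering⇒perfect : (Γ : Graph) (M : List Edge) → Unique (vertices Γ) → M ⊆ edges Γ →
                   All NonLoop M → (∀ v → occ (ends M) v ≡ occ (vertices Γ) v) →
                   IsPerfectMatching Γ M
covering⇒perfect (graph V E) M uV M⊆E nonloops same =
  All.tabulate M⊆E ,
  All.tabulate (λ {v} v∈V → trans (degree-ends nonloops v) (trans (same v) (occ-unique uV v∈V)))

data Block : Set where
  b00 b01 b10 : Block

pair : Block → Bool × Bool
pair b00 = (false , false)
pair b01 = (false , true)
pair b10 = (true , false)

-- G₁₀ is the twist: it has three low vertices and flips the state of the sweep
twist : Block → ℕ
twist b10 = 1
twist _   = 0

twists : List Block → ℕ
twists Bs = ∑ Bs twist

chainG : ℕ → List Block → Graph
chainG k Bs = graph (chainV k (map pair Bs)) (chainE k (map pair Bs))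

-- the weight of the parity obstruction: rows 0 and 1 are low
low : Point → ℕ
low p = if proj₂ p ≤ᵇ 1 then 1 else 0

shift : ℕ → Point → Point
shift k (c , r) = (k + c , r)

shift-injective : ∀ k {p q} → shift k p ≡ shift k q → p ≡ q
shift-injective k {c , r} {c' , r'} eq =
  cong₂ _,_ (ℕ.+-cancelˡ-≡ k c c' (cong proj₁ eq)) (cong proj₂ eq)

shiftE : ℕ → Edge → Edge
shiftE k (p , q) = (shift k p , shift k q)

proper-shift : ∀ k {V e} → Proper low V e → Proper low (map (shift k) V) (shiftE k e)
proper-shift k (p∈ , q∈ , p≢q , low≡) =
  ∈-map⁺ (shift k) p∈ , ∈-map⁺ (shift k) q∈ , (λ eq → p≢q (shift-injective k eq)) , low≡

blockV-at : ∀ k B → map (shift k) (blockV 0 (pair B)) ≡ blockV k (pair B)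
blockV-at k b00 rewrite ℕ.+-identityʳ k = refl
blockV-at k b01 rewrite ℕ.+-identityʳ k = refl
blockV-at k b10 rewrite ℕ.+-identityʳ k = refl

blockV-at₂ : ∀ k B → map (shift k) (blockV 2 (pair B)) ≡ blockV (k + 2) (pair B)
blockV-at₂ k b00 rewrite ℕ.+-assoc k 2 1 = refl
blockV-at₂ k b01 rewrite ℕ.+-assoc k 2 1 = refl
blockV-at₂ k b10 rewrite ℕ.+-assoc k 2 1 = refl

blockE-at : ∀ k B → map (shiftE k) (blockE 0 (pair B)) ≡ blockE k (pair B)
blockE-at k b00 rewrite ℕ.+-identityʳ k = refl
blockE-at k b01 rewrite ℕ.+-identityʳ k = refl
blockE-at k b10 rewrite ℕ.+-identityʳ k = refl

-- A property of all blocks is decided by checking the three of them; together with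
-- the decidability of Proper this lets the facts at column 0 be checked by evaluation.
∀-block? : {φ : Block → Set} → (∀ B → Dec (φ B)) → Dec (∀ B → φ B)
∀-block? φ? = map′ (λ (p , q , r) → λ { b00 → p ; b01 → q ; b10 → r })
                   (λ h → h b00 , h b01 , h b10)
                   (φ? b00 ×-dec φ? b01 ×-dec φ? b10)

proper? : (w : Point → ℕ) (V : List Point) (e : Edge) → Dec (Proper w V e)
proper? w V (p , q) = p ∈? V ×-dec q ∈? V ×-dec ¬? (p ≟P q) ×-dec w p ℕ.≟ w q

block₀-unique : ∀ B → Unique (blockV 0 (pair B))
block₀-unique = from-yes (∀-block? (λ B → unique? (blockV 0 (pair B))))

block₀-proper : ∀ B → All (Proper low (blockV 0 (pair B))) (blockE 0 (pair B))
block₀-proper = from-yes (∀-block? (λ B →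
  All.all? (proper? low (blockV 0 (pair B))) (blockE 0 (pair B))))

block₀-narrow : ∀ B → All (λ p → proj₁ p ≤ 1) (blockV 0 (pair B))
block₀-narrow = from-yes (∀-block? (λ B → All.all? (λ p → proj₁ p ≤? 1) (blockV 0 (pair B))))

link₀-proper : ∀ B C → All (Proper low (blockV 0 (pair B) ++ blockV 2 (pair C)))
                             (connect 0 (pair B) (pair C))
link₀-proper = from-yes (∀-block? (λ B → ∀-block? (λ C →
  All.all? (proper? low (blockV 0 (pair B) ++ blockV 2 (pair C))) (connect 0 (pair B) (pair C)))))

block-unique : ∀ k B → Unique (blockV k (pair B))
block-unique k B = subst Unique (blockV-at k B) (Unique.map⁺ (shift-injective k) (block₀-unique B))

block-proper : ∀ k B → All (Proper low (blockV k (pair B))) (blockE k (pair B))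
block-proper k B = subst₂ (λ V E → All (Proper low V) E) (blockV-at k B) (blockE-at k B)
                          (All.map⁺ (All.map (proper-shift k) (block₀-proper B)))

block-columns : ∀ k B → All (λ p → k ≤ proj₁ p × proj₁ p ≤ k + 1) (blockV k (pair B))
block-columns k B = subst (All _) (blockV-at k B)
  (All.map⁺ (All.map (λ {p} c≤1 → ℕ.m≤m+n k (proj₁ p) , ℕ.+-monoʳ-≤ k c≤1) (block₀-narrow B)))

link-proper : ∀ k B C → All (Proper low (blockV k (pair B) ++ blockV (k + 2) (pair C)))
                            (connect k (pair B) (pair C))
link-proper k B C = subst (λ V → All (Proper low V) (connect k (pair B) (pair C)))
  (trans (map-++ (shift k) (blockV 0 (pair B)) (blockV 2 (pair C)))
         (cong₂ _++_ (blockV-at k B) (blockV-at₂ k C)))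
  (All.map⁺ (All.map (proper-shift k) (link₀-proper B C)))

chain-columns : ∀ k Bs → All (λ p → k ≤ proj₁ p) (chainV k (map pair Bs))
chain-columns k []       = []
chain-columns k (B ∷ Bs) =
  All.++⁺ (All.map proj₁ (block-columns k B))
          (All.map (ℕ.≤-trans (ℕ.m≤m+n k 2)) (chain-columns (k + 2) Bs))

-- no vertex of a chain is listed twice: blocks occupy disjoint pairs of columns
chain-unique : ∀ k Bs → Unique (chainV k (map pair Bs))
chain-unique k []       = []
chain-unique k (B ∷ Bs) = Unique.++⁺ (block-unique k B) (chain-unique (k + 2) Bs) separated
  where
  separated : ∀ {v} → ¬ (v ∈ blockV k (pair B) × v ∈ chainV (k + 2) (map pair Bs))
  separated (v∈B , v∈rest) = ℕ.<-irrefl refl (ℕ.+-cancelˡ-≤ k 2 1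
    (ℕ.≤-trans (All.lookup (chain-columns (k + 2) Bs) v∈rest) (proj₂ (All.lookup (block-columns k B) v∈B))))

chain-proper : ∀ k Bs → All (Proper low (chainV k (map pair Bs))) (chainE k (map pair Bs))
chain-proper k []           = []
chain-proper k (B ∷ [])     = All.map (proper-weaken {low} (xs⊆xs++ys (blockV k (pair B)) [])) (block-proper k B)
chain-proper k (B ∷ C ∷ Cs) =
  All.++⁺ (All.map (proper-weaken {low} (xs⊆xs++ys this rest)) (block-proper k B))
  (All.++⁺ (All.map (proper-weaken {low} (++⁺ʳ this (xs⊆xs++ys next _))) (link-proper k B C))
           (All.map (proper-weaken {low} (xs⊆ys++xs rest this)) (chain-proper (k + 2) (C ∷ Cs))))
  where
  this : List Point
  this = blockV k (pair B)
  next : List Point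
  next = blockV (k + 2) (pair C)
  rest : List Point
  rest = chainV (k + 2) (map pair (C ∷ Cs))

block-low : ∀ k B → ∑ (blockV k (pair B)) low ≡ 2 + twist B
block-low k b00 = refl
block-low k b01 = refl
block-low k b10 = refl

chain-low : ∀ k Bs → ∑ (chainV k (map pair Bs)) low ≡ 2 * length Bs + twists Bs
chain-low k []       = refl
chain-low k (B ∷ Bs) =
  trans (∑-++ (blockV k (pair B)) (chainV (k + 2) (map pair Bs)) low)
  (trans (cong₂ _+_ (block-low k B) (chain-low (k + 2) Bs)) (regroup (twist B) (length Bs) (twists Bs)))
  where
  regroup : ∀ t n r → (2 + t) + (2 * n + r) ≡ 2 * suc n + (t + r)
  regroup = solve-∀

-- The sweep state is 1ℙ when the two link edges entering the current block are used;
-- a block passes it on, flipped iff the block is a twist.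
out : Block → Parity → Parity
out B s = parity (twist B) ⊕ s

final : Parity → Block → List Block → Parity
final s B []       = out B s
final s B (C ∷ Cs) = final (out B s) C Cs

final-parity : ∀ s B Bs → final s B Bs ≡ parity (twists (B ∷ Bs)) ⊕ s
final-parity s B []       = cong (λ n → parity n ⊕ s) (sym (ℕ.+-identityʳ (twist B)))
final-parity s B (C ∷ Cs) = begin
  final (out B s) C Cs                ≡⟨ final-parity (out B s) C Cs ⟩
  rest ⊕ (parity (twist B) ⊕ s)       ≡⟨ sym (Parity.+-assoc rest (parity (twist B)) s) ⟩
  (rest ⊕ parity (twist B)) ⊕ s       ≡⟨ cong (_⊕ s) (Parity.+-comm rest (parity (twist B))) ⟩
  (parity (twist B) ⊕ rest) ⊕ s       ≡⟨ cong (_⊕ s) (sym (Parity.+-homo-+ (twist B) (twists (C ∷ Cs)))) ⟩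
  parity (twists (B ∷ C ∷ Cs)) ⊕ s    ∎
  where
  open ≡-Reasoning
  rest : Parity
  rest = parity (twists (C ∷ Cs))

even⇒parity0 : ∀ {n} → 2 ∣ n → parity n ≡ 0ℙ
even⇒parity0 (divides q refl) = trans (Parity.*-homo-* q 2) (Parity.*-zeroʳ (parity q))

-- the vertices of block B covered by the incoming, resp. outgoing, link edges in state s
inPorts : ℕ → Block → Parity → List Point
inPorts k B 0ℙ = []
inPorts k B 1ℙ = (k , bOf (pair B)) ∷ (k , 5 ∸ bOf (pair B)) ∷ []

outPorts : ℕ → Block → Parity → List Point
outPorts k B 0ℙ = []
outPorts k B 1ℙ = (k + 1 , aOf (pair B)) ∷ (k + 1 , 5 ∸ aOf (pair B)) ∷ []

blockM : ℕ → Block → Parity → List Edge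
blockM k b00 0ℙ = ((k , 0) , (k + 1 , 0)) ∷ ((k , 5) , (k + 1 , 5)) ∷ ((k , 2) , (k , 3)) ∷ []
blockM k b00 1ℙ = ((k , 2) , (k , 3)) ∷ []
blockM k b01 0ℙ = ((k , 1) , (k + 1 , 1)) ∷ ((k , 4) , (k + 1 , 4)) ∷ ((k + 1 , 2) , (k + 1 , 3)) ∷ []
blockM k b01 1ℙ = ((k + 1 , 2) , (k + 1 , 3)) ∷ []
blockM k b10 0ℙ = ((k , 0) , (k , 1)) ∷ ((k , 5) , (k , 4)) ∷ []
blockM k b10 1ℙ = ((k , 0) , (k + 1 , 0)) ∷ ((k , 5) , (k + 1 , 5)) ∷ []

link : ℕ → Block → Block → Parity → List Edge
link k B C 0ℙ = []
link k B C 1ℙ = connect k (pair B) (pair C)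

-- The three orders in which a block's six vertices a…f (listed as in blockV) are met
-- along in-ports, chosen block edges and out-ports.
ports-through : ∀ a b c d e f → a + (c + (e + (f + (b + (d + 0))))) ≡ a + (b + (c + (d + (e + (f + 0)))))
ports-through = solve-∀

ports-exit : ∀ a b c d e f → a + (e + (c + (f + (b + (d + 0))))) ≡ a + (b + (c + (d + (e + (f + 0)))))
ports-exit = solve-∀

ports-enter : ∀ a b c d e f → e + (f + (a + (b + (c + (d + 0))))) ≡ a + (b + (c + (d + (e + (f + 0)))))
ports-enter = solve-∀

block-balance : ∀ k B s v →
  occ (inPorts k B s ++ ends (blockM k B s) ++ outPorts k B (out B s)) v ≡ occ (blockV k (pair B)) v
block-balance k b00 0ℙ v = refl
block-balance k b00 1ℙ v =
  ports-through (δ v (k , 0)) (δ v (k + 1 , 0)) (δ v (k , 5)) (δ v (k + 1 , 5)) (δ v (k , 2)) (δ v (k , 3))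
block-balance k b01 0ℙ v = refl
block-balance k b01 1ℙ v =
  ports-through (δ v (k , 1)) (δ v (k + 1 , 1)) (δ v (k , 4)) (δ v (k + 1 , 4)) (δ v (k + 1 , 2)) (δ v (k + 1 , 3))
block-balance k b10 0ℙ v =
  ports-exit (δ v (k , 0)) (δ v (k + 1 , 0)) (δ v (k , 5)) (δ v (k + 1 , 5)) (δ v (k , 1)) (δ v (k , 4))
block-balance k b10 1ℙ v =
  ports-enter (δ v (k , 0)) (δ v (k + 1 , 0)) (δ v (k , 5)) (δ v (k + 1 , 5)) (δ v (k , 1)) (δ v (k , 4))

link-balance : ∀ k B C s v →
  occ (ends (link k B C s)) v ≡ occ (outPorts k B s) v + occ (inPorts (k + 2) C s) v
link-balance k B C 0ℙ v = refl
link-balance k B C 1ℙ v =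
  swap-middle (δ v (k + 1 , aOf (pair B))) (δ v (k + 2 , bOf (pair C)))
              (δ v (k + 1 , 5 ∸ aOf (pair B))) (δ v (k + 2 , 5 ∸ bOf (pair C)))
  where
  swap-middle : ∀ a b c d → a + (b + (c + (d + 0))) ≡ (a + (c + 0)) + (b + (d + 0))
  swap-middle = solve-∀

chainM : ℕ → Parity → Block → List Block → List Edge
chainM k s B []       = blockM k B s
chainM k s B (C ∷ Cs) = blockM k B s ++ link k B C (out B s) ++ chainM (k + 2) (out B s) C Cs

chain-balance : ∀ k s B Bs → final s B Bs ≡ 0ℙ → ∀ v →
  occ (inPorts k B s ++ ends (chainM k s B Bs)) v ≡ occ (chainV k (map pair (B ∷ Bs))) v
chain-balance k s B [] ended v = begin
  occ (I ++ ends M) v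
    ≡⟨ cong (λ L → occ (I ++ L) v) (sym (++-identityʳ (ends M))) ⟩
  occ (I ++ ends M ++ []) v
    ≡⟨ cong (λ t → occ (I ++ ends M ++ outPorts k B t) v) (sym ended) ⟩
  occ (I ++ ends M ++ outPorts k B (out B s)) v
    ≡⟨ block-balance k B s v ⟩
  occ (blockV k (pair B)) v
    ≡⟨ cong (λ L → occ L v) (sym (++-identityʳ (blockV k (pair B)))) ⟩
  occ (blockV k (pair B) ++ []) v
    ∎
  where
  open ≡-Reasoning
  I : List Point
  I = inPorts k B s
  M : List Edge
  M = blockM k B s
chain-balance k s B (C ∷ Cs) ended v = begin
  occ (I ++ ends (M ++ L ++ R)) v
    ≡⟨ trans (occ-++ I _ v) (cong (occ I v +_)
         (trans (occ-ends-++ M _ v) (cong (occ (ends M) v +_) (occ-ends-++ L R v)))) ⟩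
  occ I v + (occ (ends M) v + (occ (ends L) v + occ (ends R) v))
    ≡⟨ cong (λ n → occ I v + (occ (ends M) v + (n + occ (ends R) v))) (link-balance k B C o v) ⟩
  occ I v + (occ (ends M) v + ((occ O v + occ I′ v) + occ (ends R) v))
    ≡⟨ regroup (occ I v) (occ (ends M) v) (occ O v) (occ I′ v) (occ (ends R) v) ⟩
  (occ I v + (occ (ends M) v + occ O v)) + (occ I′ v + occ (ends R) v)
    ≡⟨ cong₂ _+_ (sym (trans (occ-++ I _ v) (cong (occ I v +_) (occ-++ (ends M) O v))))
                 (sym (occ-++ I′ (ends R) v)) ⟩
  occ (I ++ ends M ++ O) v + occ (I′ ++ ends R) v
    ≡⟨ cong₂ _+_ (block-balance k B s v) (chain-balance (k + 2) o C Cs ended v) ⟩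
  occ (blockV k (pair B)) v + occ (chainV (k + 2) (map pair (C ∷ Cs))) v
    ≡⟨ sym (occ-++ (blockV k (pair B)) _ v) ⟩
  occ (chainV k (map pair (B ∷ C ∷ Cs))) v
    ∎
  where
  open ≡-Reasoning
  regroup : ∀ i m o j r → i + (m + ((o + j) + r)) ≡ (i + (m + o)) + (j + r)
  regroup = solve-∀
  o : Parity
  o = out B s
  I : List Point
  I = inPorts k B s
  O : List Point
  O = outPorts k B o
  I′ : List Point
  I′ = inPorts (k + 2) C o
  M : List Edge
  M = blockM k B s
  L : List Edge
  L = link k B C o
  R : List Edge
  R = chainM (k + 2) o C Cs

blockM-⊆ : ∀ k B s → blockM k B s ⊆ blockE k (pair B)
blockM-⊆ k B s = All.lookup (positions B s)
  where
  positions : ∀ B s → All (_∈ blockE k (pair B)) (blockM k B s)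
  positions b00 0ℙ = All.tabulate id
  positions b00 1ℙ = there (there (here refl)) ∷ []
  positions b01 0ℙ = All.tabulate id
  positions b01 1ℙ = there (there (here refl)) ∷ []
  positions b10 0ℙ = there (here refl) ∷ there (there (there (here refl))) ∷ []
  positions b10 1ℙ = here refl ∷ there (there (here refl)) ∷ []

link-⊆ : ∀ k B C s → link k B C s ⊆ connect k (pair B) (pair C)
link-⊆ k B C 0ℙ ()
link-⊆ k B C 1ℙ = ⊆-refl

chainM-⊆ : ∀ k s B Bs → chainM k s B Bs ⊆ chainE k (map pair (B ∷ Bs))
chainM-⊆ k s B []       = blockM-⊆ k B s
chainM-⊆ k s B (C ∷ Cs) =
  ++⁺ (blockM-⊆ k B s) (++⁺ (link-⊆ k B C (out B s)) (chainM-⊆ (k + 2) (out B s) C Cs))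

sweep-perfect : ∀ k B Bs → 2 ∣ twists (B ∷ Bs) → IsPerfectMatching (chainG k (B ∷ Bs)) (chainM k 0ℙ B Bs)
sweep-perfect k B Bs even =
  covering⇒perfect (chainG k (B ∷ Bs)) (chainM k 0ℙ B Bs) (chain-unique k (B ∷ Bs)) M⊆E nonloops
                   (chain-balance k 0ℙ B Bs ended)
  where
  M⊆E : chainM k 0ℙ B Bs ⊆ chainE k (map pair (B ∷ Bs))
  M⊆E = chainM-⊆ k 0ℙ B Bs
  nonloops : All NonLoop (chainM k 0ℙ B Bs)
  nonloops = All.tabulate (λ e∈M → proper-nonloop {low} (All.lookup (chain-proper k (B ∷ Bs)) (M⊆E e∈M)))
  ended : final 0ℙ B Bs ≡ 0ℙ
  ended = trans (final-parity 0ℙ B Bs) (trans (Parity.+-identityʳ _) (even⇒parity0 even))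

chain-theorem : ∀ k Bs → HasPerfectMatching (chainG k Bs) ⇔ 2 ∣ twists Bs
chain-theorem k Bs = mk⇔ matchable⇒even (even⇒matchable Bs)
  where
  matchable⇒even : HasPerfectMatching (chainG k Bs) → 2 ∣ twists Bs
  matchable⇒even matching =
    ∣m+n∣m⇒∣n (subst (2 ∣_) (chain-low k Bs)
                     (perfect⇒even low (chainG k Bs) (chain-unique k Bs) (chain-proper k Bs) matching))
              (m∣m*n (length Bs))
  even⇒matchable : ∀ Bs → 2 ∣ twists Bs → HasPerfectMatching (chainG k Bs)
  even⇒matchable []       _    = [] , [] , []
  even⇒matchable (B ∷ Cs) even = chainM k 0ℙ B Cs , sweep-perfect k B Cs even

rise : Bool → Block
rise false = b00
rise true  = b01

fall : Bool → Block
fall false = b00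
fall true  = b10

blocks : List Bool → List Block
blocks []      = b00 ∷ []
blocks (b ∷ x) = rise b ∷ fall b ∷ blocks x

pair-rise : ∀ b → pair (rise b) ≡ (false , b)
pair-rise false = refl
pair-rise true  = refl

pair-fall : ∀ b → pair (fall b) ≡ (b , false)
pair-fall false = refl
pair-fall true  = refl

pairs-tail : ∀ c x → pairs (c ∷ bd (interleave x) ++ false ∷ []) ≡ map pair (fall c ∷ blocks x)
pairs-tail c []      = cong (λ P → P ∷ (false , false) ∷ []) (sym (pair-fall c))
pairs-tail c (b ∷ x) =
  cong₂ _∷_ (sym (pair-fall c)) (cong₂ _∷_ (sym (pair-rise b)) (pairs-tail b x))

pairs-f : ∀ x → pairs (f x) ≡ map pair (b00 ∷ blocks x)
pairs-f = pairs-tail false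

twists-blocks : ∀ x → twists (blocks x) ≡ ones x
twists-blocks []          = refl
twists-blocks (false ∷ x) = twists-blocks x
twists-blocks (true ∷ x)  = cong suc (twists-blocks x)

lemma5 : (x : List Bool) → HasPerfectMatching (G x) ⇔ (2 ∣ ones x)
lemma5 x =
  subst (λ Ps → HasPerfectMatching (graph (chainV 0 Ps) (chainE 0 Ps)) ⇔ (2 ∣ ones x)) (sym (pairs-f x))
        (subst (λ n → HasPerfectMatching (chainG 0 (b00 ∷ blocks x)) ⇔ (2 ∣ n)) (twists-blocks x)
               (chain-theorem 0 (b00 ∷ blocks x)))
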